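{- Let $n\ge 3$ and let $U=U(C_n,\{T_{m_1},\dots,T_{m_k}\})$ be the signed unicyclic graph consisting of a signed cycle $C_n$ and $k$ pairwise vertex-disjoint signed trees $T_{m_1},\dots,T_{m_k}$ (with $m_i$ vertices), where the root of each $T_{m_i}$ is joined by an edge to the same fixed vertex $v$ of $C_n$. Then $$\det U=\det(C_n)\prod_{i=1}^k\det(T_{m_i})+\det(P_{n-1})\sum_{i=1}^k\Big(\det(\{T_{m_i},v\})\prod_{j=1,\,j\ne i}^k\det(T_{m_j})\Big).$$
   Context: A signed graph has edge weights in $\{1,-1\}$ and its determinant is the determinant of its adjacency matrix. $P_{n-1}$ denotes the signed path $C_n\setminus v$ on $n-1$ vertices, and $\{T_{m_i},v\}$ denotes the subgraph of $U$ induced by the vertices of $T_{m_i}$ together with $v$. -}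

module Defs where

open import Data.Nat as ℕ using (ℕ; zero; suc; _%_)
open import Data.Integer as ℤ using (ℤ; 0ℤ; 1ℤ; -1ℤ; _+_; _-_; _*_)
open import Data.Fin as Fin using (Fin; zero; suc; toℕ; punchIn)
open import Data.Product using (Σ; _,_; _×_; ∃-syntax)
open import Data.Sum using (_⊎_; inj₁; inj₂)
open import Data.Bool using (if_then_else_)
open import Relation.Nullary using (¬_; yes; no; does)
open import Relation.Binary.PropositionalEquality using (_≡_; refl)
open import Relation.Binary.Construct.Closure.ReflexiveTransitive using (Star)

Mat : ℕ → Set
Mat n = Fin n → Fin n → ℤ

altSum : ∀ n → (Fin n → ℤ) → ℤ
altSum zero    f = 0ℤ
altSum (suc n) f = f zero - altSum n (λ j → f (suc j))

minor0 : ∀ {n} → Mat (suc n) → Fin (suc n) → Mat n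
minor0 A j r c = A (suc r) (punchIn j c)

det : ∀ n → Mat n → ℤ
det zero    A = 1ℤ
det (suc n) A = altSum (suc n) (λ j → A zero j * det n (minor0 A j))

deleteVertex : ∀ {n} → Mat (suc n) → Fin (suc n) → Mat n
deleteVertex A v i j = A (punchIn v i) (punchIn v j)

sumF : ∀ k → (Fin k → ℤ) → ℤ
sumF zero    f = 0ℤ
sumF (suc k) f = f zero + sumF k (λ i → f (suc i))

prodF : ∀ k → (Fin k → ℤ) → ℤ
prodF zero    f = 1ℤ
prodF (suc k) f = f zero * prodF k (λ i → f (suc i))

sumℕ : ∀ k → (Fin k → ℕ) → ℕ
sumℕ zero    f = 0
sumℕ (suc k) f = f zero ℕ.+ sumℕ k (λ i → f (suc i))

IsSign : ℤ → Set
IsSign x = (x ≡ 1ℤ) ⊎ (x ≡ -1ℤ)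

IsSignedGraph : ∀ {n} → Mat n → Set
IsSignedGraph {n} A =
  (∀ i j → A i j ≡ A j i) ×
  (∀ i → A i i ≡ 0ℤ) ×
  (∀ i j → (A i j ≡ 0ℤ) ⊎ IsSign (A i j))

Adjacent : ∀ {n} → Mat n → Fin n → Fin n → Set
Adjacent A i j = ¬ (A i j ≡ 0ℤ)

Connected : ∀ {n} → Mat n → Set
Connected A = ∀ i j → Star (Adjacent A) i j

numEdges : ∀ {n} → Mat n → ℕ
numEdges {n} A = sumℕ n (λ i → sumℕ n (λ j →
  if does (toℕ i ℕ.<? toℕ j)
  then (if does (A i j ℤ.≟ 0ℤ) then 0 else 1)
  else 0))

IsSignedTree : ∀ {m} → Mat m → Set
IsSignedTree {m} A = IsSignedGraph A × Connected A × (numEdges A ≡ m ℕ.∸ 1)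

-- The signed cycle C_n on vertices 0,…,n-1 with edges {i, i+1 mod n},
-- the edge {i, i+1 mod n} having sign s i.

cycleMat : ∀ n → (Fin n → ℤ) → Mat n
cycleMat zero s ()
cycleMat (suc n) s i j with ℕ.suc (toℕ i) % suc n ℕ.≟ toℕ j | ℕ.suc (toℕ j) % suc n ℕ.≟ toℕ i
... | yes _ | _     = s i
... | no _  | yes _ = s j
... | no _  | no _  = 0ℤ

UVertex : ∀ n k → (Fin k → ℕ) → Set
UVertex n k m = Fin n ⊎ Σ (Fin k) (λ i → Fin (m i))

joinWeight : ∀ {n k} {m : Fin k → ℕ} →
  Fin n → (r : (i : Fin k) → Fin (m i)) → (w : Fin k → ℤ) →
  Fin n → (i : Fin k) → Fin (m i) → ℤ
joinWeight v r w a i x with a Fin.≟ v | x Fin.≟ r i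
... | yes _ | yes _ = w i
... | _     | _     = 0ℤ

treeBlock : ∀ {k} {m : Fin k → ℕ} → (T : (i : Fin k) → Mat (m i)) →
  (i : Fin k) → Fin (m i) → (j : Fin k) → Fin (m j) → ℤ
treeBlock T i x j y with i Fin.≟ j
... | yes refl = T i x y
... | no _     = 0ℤ

UMat : ∀ n k (m : Fin k → ℕ) →
  (C : Mat n) → (T : (i : Fin k) → Mat (m i)) →
  (r : (i : Fin k) → Fin (m i)) → (w : Fin k → ℤ) → (v : Fin n) →
  UVertex n k m → UVertex n k m → ℤ
UMat n k m C T r w v (inj₁ a)       (inj₁ b)       = C a b
UMat n k m C T r w v (inj₁ a)       (inj₂ (j , y)) = joinWeight v r w a j y
UMat n k m C T r w v (inj₂ (i , x)) (inj₁ b)       = joinWeight v r w b i x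
UMat n k m C T r w v (inj₂ (i , x)) (inj₂ (j , y)) = treeBlock T i x j y

-- {T, v}: the subgraph induced by T and v; vertex 0 is v, vertex suc x is x of T,
-- v joined to the root r with weight w
withVertex : ∀ {m} → Mat m → Fin m → ℤ → Mat (suc m)
withVertex T r w zero    zero    = 0ℤ
withVertex T r w zero    (suc y) = if does (y Fin.≟ r) then w else 0ℤ
withVertex T r w (suc x) zero    = if does (x Fin.≟ r) then w else 0ℤ
withVertex T r w (suc x) (suc y) = T x y

deleteDet : ∀ n → Mat n → Fin n → ℤ
deleteDet zero    A ()
deleteDet (suc n) A v = det n (deleteVertex A v)

-- Order the vertices of U as v, the trees, then the path C_n \ v; the determinant is
-- invariant under this reindexing because every permutation is a product of adjacent
-- transpositions, each of which fixes det when applied to rows and columns together.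
-- Now v is a cut vertex with zero diagonal entry separating Y (the trees) from Z (the
-- path).  Splitting the first row into its Y- and Z-parts and expanding each part as a
-- block-triangular matrix gives
--   det A = det A[v ∪ Y] · det A[Z] + det A[Y] · det A[v ∪ Z].
-- Here A[v ∪ Z] = C_n, A[Z] = P_{n-1}, A[Y] is block diagonal with determinant ∏ det Tᵢ,
-- and A[v ∪ Y] is a star of trees at v, whose determinant is the sum in the theorem by
-- the same cut-vertex formula applied one tree at a time.

module Submission where

open import Defs
open import Data.Nat using (ℕ; suc; _≤_)
open import Data.Integer using (ℤ; 1ℤ; _+_; _*_)
open import Data.Fin using (Fin; _≟_)
open import Data.Bool using (if_then_else_)
open import Relation.Nullary using (does)
open import Relation.Binary.PropositionalEquality using (_≡_)
open import Function.Bundles using (_↔_; Inverse)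

open import Data.Nat as ℕ using (zero; _%_; s≤s)
import Data.Nat.Properties as ℕ
open import Data.Nat.DivMod using (m<n⇒m%n≡m; n%n≡0)
open import Data.Integer using (0ℤ; -1ℤ; _-_; -_)
import Data.Integer.Properties as ℤ
open import Data.Integer.Tactic.RingSolver using (solve-∀)
open import Data.Fin using (zero; suc; punchIn; punchOut; _↑ˡ_; _↑ʳ_; splitAt; toℕ)
import Data.Fin.Properties as Fin
open import Data.Fin.Permutation using (Permutation′; _⟨$⟩ʳ_; remove; lift₀; ↔⇒≡)
open import Data.Product as Σ using (Σ; _,_; _×_; proj₁; proj₂)
open import Function.Base using (id)
open import Data.Sum using (_⊎_; inj₁; inj₂; [_,_]′)
open import Data.Sum.Algebra using (⊎-comm)
open import Data.List using (List; []; _∷_; _++_; map)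
open import Data.Empty using (⊥-elim)
open import Relation.Nullary using (¬_; yes; no)
open import Relation.Binary.PropositionalEquality
  using (refl; sym; trans; cong; cong₂; module ≡-Reasoning)
open import Function.Bundles using (mk↔ₛ′)
open import Function.Construct.Composition using (_↔-∘_)
open import Function.Construct.Symmetry using (↔-sym)

sumF-cong : ∀ n {f g : Fin n → ℤ} → (∀ i → f i ≡ g i) → sumF n f ≡ sumF n g
sumF-cong zero    f≗g = refl
sumF-cong (suc n) f≗g = cong₂ _+_ (f≗g zero) (sumF-cong n (λ i → f≗g (suc i)))

sumF-+ : ∀ n (f g : Fin n → ℤ) → sumF n (λ i → f i + g i) ≡ sumF n f + sumF n g
sumF-+ zero    f g = refl
sumF-+ (suc n) f g rewrite sumF-+ n (λ i → f (suc i)) (λ i → g (suc i)) =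
  interchange (f zero) (g zero) (sumF n (λ i → f (suc i))) (sumF n (λ i → g (suc i)))
  where interchange : ∀ a b c d → a + b + (c + d) ≡ a + c + (b + d)
        interchange = solve-∀

sumF-*ˡ : ∀ n c (f : Fin n → ℤ) → sumF n (λ i → c * f i) ≡ c * sumF n f
sumF-*ˡ zero    c f = sym (ℤ.*-zeroʳ c)
sumF-*ˡ (suc n) c f rewrite sumF-*ˡ n c (λ i → f (suc i)) =
  sym (ℤ.*-distribˡ-+ c (f zero) _)

sumF-*ʳ : ∀ n c (f : Fin n → ℤ) → sumF n (λ i → f i * c) ≡ sumF n f * c
sumF-*ʳ n c f = trans (sumF-cong n (λ i → ℤ.*-comm (f i) c))
                      (trans (sumF-*ˡ n c f) (ℤ.*-comm c _))

sumF-neg : ∀ n (f : Fin n → ℤ) → sumF n (λ i → - f i) ≡ - sumF n f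
sumF-neg n f = trans (sumF-cong n (λ i → sym (ℤ.-1*i≡-i (f i))))
                     (trans (sumF-*ˡ n -1ℤ f) (ℤ.-1*i≡-i _))

sumF-zero : ∀ n {f : Fin n → ℤ} → (∀ i → f i ≡ 0ℤ) → sumF n f ≡ 0ℤ
sumF-zero zero    f≗0 = refl
sumF-zero (suc n) f≗0 rewrite f≗0 zero | sumF-zero n (λ i → f≗0 (suc i)) = refl

sumF-comm : ∀ a b (f : Fin a → Fin b → ℤ) →
  sumF a (λ i → sumF b (f i)) ≡ sumF b (λ j → sumF a (λ i → f i j))
sumF-comm zero    b f = sym (sumF-zero b (λ _ → refl))
sumF-comm (suc a) b f rewrite sumF-comm a b (λ i → f (suc i)) =
  sym (sumF-+ b (f zero) (λ j → sumF a (λ i → f (suc i) j)))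

sumF-punchIn : ∀ n (a : Fin (suc n)) (f : Fin (suc n) → ℤ) →
  sumF (suc n) f ≡ f a + sumF n (λ l → f (punchIn a l))
sumF-punchIn n       zero    f = refl
sumF-punchIn (suc n) (suc a) f rewrite sumF-punchIn n a (λ i → f (suc i)) =
  left-comm (f zero) (f (suc a)) (sumF n (λ l → f (suc (punchIn a l))))
  where left-comm : ∀ x y z → x + (y + z) ≡ y + (x + z)
        left-comm = solve-∀

sumF-↑ˡ : ∀ a b (f : Fin (a ℕ.+ b) → ℤ) → (∀ j → f (a ↑ʳ j) ≡ 0ℤ) →
  sumF (a ℕ.+ b) f ≡ sumF a (λ i → f (i ↑ˡ b))
sumF-↑ˡ zero    b f f≗0 = sumF-zero b f≗0
sumF-↑ˡ (suc a) b f f≗0 = cong (f zero +_) (sumF-↑ˡ a b (λ i → f (suc i)) f≗0)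

prodF-cong : ∀ n {f g : Fin n → ℤ} → (∀ i → f i ≡ g i) → prodF n f ≡ prodF n g
prodF-cong zero    f≗g = refl
prodF-cong (suc n) f≗g = cong₂ _*_ (f≗g zero) (prodF-cong n (λ i → f≗g (suc i)))

altSign : ∀ {n} → Fin n → ℤ
altSign zero    = 1ℤ
altSign (suc i) = - altSign i

altSum≡sumF : ∀ n (f : Fin n → ℤ) → altSum n f ≡ sumF n (λ j → altSign j * f j)
altSum≡sumF zero    f = refl
altSum≡sumF (suc n) f = begin
  f zero - altSum n (λ j → f (suc j))
    ≡⟨ cong (λ z → f zero - z) (altSum≡sumF n (λ j → f (suc j))) ⟩
  f zero + - sumF n (λ j → altSign j * f (suc j))
    ≡⟨ cong₂ _+_ (sym (ℤ.*-identityˡ (f zero))) (sym (sumF-neg n _)) ⟩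
  1ℤ * f zero + sumF n (λ j → - (altSign j * f (suc j)))
    ≡⟨ cong (1ℤ * f zero +_) (sumF-cong n (λ j → ℤ.neg-distribˡ-* (altSign j) (f (suc j)))) ⟩
  1ℤ * f zero + sumF n (λ j → - altSign j * f (suc j)) ∎
  where open ≡-Reasoning

laplaceTerm : ∀ {n} → Mat (suc n) → Fin (suc n) → ℤ
laplaceTerm {n} A j = altSign j * (A zero j * det n (minor0 A j))

det-expand : ∀ n (A : Mat (suc n)) → det (suc n) A ≡ sumF (suc n) (laplaceTerm A)
det-expand n A = altSum≡sumF (suc n) (λ j → A zero j * det n (minor0 A j))

det-cong : ∀ n {A B : Mat n} → (∀ i j → A i j ≡ B i j) → det n A ≡ det n B
det-cong zero    A≗B = refl
det-cong (suc n) {A} {B} A≗B = trans (det-expand n A) (trans (sumF-cong (suc n) (λ j →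
  cong₂ (λ x y → altSign j * (x * y)) (A≗B zero j) (det-cong n (λ r c → A≗B (suc r) (punchIn j c)))))
  (sym (det-expand n B)))

-- Invariance under simultaneous permutation of rows and columns

adjSwap : ∀ {n} → Fin n → Fin (suc n) → Fin (suc n)
adjSwap zero    zero          = suc zero
adjSwap zero    (suc zero)    = zero
adjSwap zero    (suc (suc x)) = suc (suc x)
adjSwap (suc j) zero          = zero
adjSwap (suc j) (suc x)       = suc (adjSwap j x)

adjSwap-involutive : ∀ {n} (j : Fin n) x → adjSwap j (adjSwap j x) ≡ x
adjSwap-involutive zero    zero          = refl
adjSwap-involutive zero    (suc zero)    = refl
adjSwap-involutive zero    (suc (suc x)) = refl
adjSwap-involutive (suc j) zero          = refl
adjSwap-involutive (suc j) (suc x)       = cong suc (adjSwap-involutive j x)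

sumF-adjSwap : ∀ n (j : Fin n) (f : Fin (suc n) → ℤ) →
  sumF (suc n) (λ c → f (adjSwap j c)) ≡ sumF (suc n) f
sumF-adjSwap (suc n) zero    f = left-comm (f zero) (f (suc zero)) (sumF n (λ i → f (suc (suc i))))
  where left-comm : ∀ x y z → y + (x + z) ≡ x + (y + z)
        left-comm = solve-∀
sumF-adjSwap (suc n) (suc j) f = cong (f zero +_) (sumF-adjSwap n j (λ i → f (suc i)))

-- Total version of punchOut: the position of b among the indices other than a
-- (junk value when a = b).
indexWithout : ∀ {n} → Fin (suc (suc n)) → Fin (suc (suc n)) → Fin (suc n)
indexWithout zero    zero                = zero
indexWithout zero    (suc b)             = b
indexWithout (suc a) zero                = zero
indexWithout {zero}  (suc a) (suc b)     = zero
indexWithout {suc n} (suc a) (suc b)     = suc (indexWithout a b)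

indexWithout-punchIn : ∀ {n} (a : Fin (suc (suc n))) l → indexWithout a (punchIn a l) ≡ l
indexWithout-punchIn zero          l       = refl
indexWithout-punchIn (suc a)       zero    = refl
indexWithout-punchIn {zero}  (suc a) (suc ())
indexWithout-punchIn {suc n} (suc a) (suc l) = cong suc (indexWithout-punchIn a l)

punchIn-indexWithout-comm : ∀ {n} (a b : Fin (suc (suc n))) → ¬ a ≡ b → ∀ c →
  punchIn a (punchIn (indexWithout a b) c) ≡ punchIn b (punchIn (indexWithout b a) c)
punchIn-indexWithout-comm zero    zero    a≢b c = ⊥-elim (a≢b refl)
punchIn-indexWithout-comm zero    (suc b) a≢b c = refl
punchIn-indexWithout-comm (suc a) zero    a≢b c = refl
punchIn-indexWithout-comm {zero}  (suc zero) (suc zero) a≢b c = ⊥-elim (a≢b refl)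
punchIn-indexWithout-comm {suc n} (suc a) (suc b) a≢b zero    = refl
punchIn-indexWithout-comm {suc n} (suc a) (suc b) a≢b (suc c) =
  cong suc (punchIn-indexWithout-comm a b (λ a≡b → a≢b (cong suc a≡b)) c)

altSign-indexWithout : ∀ {n} (a b : Fin (suc (suc n))) → ¬ a ≡ b →
  altSign a * altSign (indexWithout a b) ≡ - (altSign b * altSign (indexWithout b a))
altSign-indexWithout zero    zero    a≢b = ⊥-elim (a≢b refl)
altSign-indexWithout zero    (suc b) a≢b = lemma (altSign b)
  where lemma : ∀ x → 1ℤ * x ≡ - (- x * 1ℤ)
        lemma = solve-∀
altSign-indexWithout (suc a) zero    a≢b = lemma (altSign a)
  where lemma : ∀ x → - x * 1ℤ ≡ - (1ℤ * x)
        lemma = solve-∀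
altSign-indexWithout {zero}  (suc zero) (suc zero) a≢b = ⊥-elim (a≢b refl)
altSign-indexWithout {suc n} (suc a) (suc b) a≢b =
  trans (neg*neg (altSign a) (altSign (indexWithout a b)))
  (trans (altSign-indexWithout a b (λ a≡b → a≢b (cong suc a≡b)))
         (cong -_ (sym (neg*neg (altSign b) (altSign (indexWithout b a))))))
  where neg*neg : ∀ x y → - x * - y ≡ x * y
        neg*neg = solve-∀

minor01 : ∀ {n} → Mat (suc (suc n)) → Fin (suc (suc n)) → Fin (suc (suc n)) → Mat n
minor01 A a b r c = A (suc (suc r)) (punchIn a (punchIn (indexWithout a b) c))

-- The term of the row-1 expansion of  minor0 A a  at the original column b.
rowOneTerm : ∀ {n} → Mat (suc (suc n)) → Fin (suc (suc n)) → Fin (suc (suc n)) → ℤ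
rowOneTerm {n} A a b =
  if does (a ≟ b) then 0ℤ
  else altSign (indexWithout a b) * (A (suc zero) b * det n (minor01 A a b))

rowOneTerm-diag : ∀ {n} (A : Mat (suc (suc n))) a → rowOneTerm A a a ≡ 0ℤ
rowOneTerm-diag A a with a ≟ a
... | yes _  = refl
... | no a≢a = ⊥-elim (a≢a refl)

rowOneTerm-punchIn : ∀ {n} (A : Mat (suc (suc n))) a l → rowOneTerm A a (punchIn a l) ≡
  altSign l * (A (suc zero) (punchIn a l) * det n (minor0 (minor0 A a) l))
rowOneTerm-punchIn {n} A a l with a ≟ punchIn a l
... | yes a≡ = ⊥-elim (Fin.punchInᵢ≢i a l (sym a≡))
... | no _   = cong₂ (λ x y → altSign x * (A (suc zero) (punchIn a l) * y))
  (indexWithout-punchIn a l)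
  (det-cong n (λ r c → cong (λ z → A (suc (suc r)) (punchIn a (punchIn z c))) (indexWithout-punchIn a l)))

det-minor0 : ∀ n (A : Mat (suc (suc n))) a →
  det (suc n) (minor0 A a) ≡ sumF (suc (suc n)) (rowOneTerm A a)
det-minor0 n A a = trans (det-expand n (minor0 A a)) (sym (begin
  sumF (suc (suc n)) (rowOneTerm A a)
    ≡⟨ sumF-punchIn (suc n) a (rowOneTerm A a) ⟩
  rowOneTerm A a a + sumF (suc n) (λ l → rowOneTerm A a (punchIn a l))
    ≡⟨ cong₂ _+_ (rowOneTerm-diag A a) (sumF-cong (suc n) (rowOneTerm-punchIn A a)) ⟩
  0ℤ + sumF (suc n) (laplaceTerm (minor0 A a))
    ≡⟨ ℤ.+-identityˡ _ ⟩
  sumF (suc n) (laplaceTerm (minor0 A a)) ∎))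
  where open ≡-Reasoning

pairTerm : ∀ {n} → Mat (suc (suc n)) → Fin (suc (suc n)) → Fin (suc (suc n)) → ℤ
pairTerm A a b = altSign a * (A zero a * rowOneTerm A a b)

det-pairExpansion : ∀ n (A : Mat (suc (suc n))) →
  det (suc (suc n)) A ≡ sumF (suc (suc n)) (λ a → sumF (suc (suc n)) (pairTerm A a))
det-pairExpansion n A = trans (det-expand (suc n) A) (sumF-cong (suc (suc n)) λ a → begin
  altSign a * (A zero a * det (suc n) (minor0 A a))
    ≡⟨ cong (λ z → altSign a * (A zero a * z)) (det-minor0 n A a) ⟩
  altSign a * (A zero a * sumF (suc (suc n)) (rowOneTerm A a))
    ≡⟨ cong (altSign a *_) (sym (sumF-*ˡ (suc (suc n)) (A zero a) (rowOneTerm A a))) ⟩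
  altSign a * sumF (suc (suc n)) (λ b → A zero a * rowOneTerm A a b)
    ≡⟨ sym (sumF-*ˡ (suc (suc n)) (altSign a) (λ b → A zero a * rowOneTerm A a b)) ⟩
  sumF (suc (suc n)) (pairTerm A a) ∎)
  where open ≡-Reasoning

pairTerm-swapRows : ∀ {n} (A : Mat (suc (suc n))) a b →
  pairTerm (λ r c → A (adjSwap zero r) c) a b ≡ - pairTerm A b a
pairTerm-swapRows {n} A a b with a ≟ b | b ≟ a
... | yes _   | yes _   = lemma (altSign a) (A (suc zero) a) (altSign b) (A zero b)
  where lemma : ∀ x y z w → x * (y * 0ℤ) ≡ - (z * (w * 0ℤ))
        lemma = solve-∀
... | yes a≡b | no b≢a  = ⊥-elim (b≢a (sym a≡b))
... | no a≢b  | yes b≡a = ⊥-elim (a≢b (sym b≡a))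
... | no a≢b  | no _
  rewrite det-cong n {minor01 A b a} {minor01 A a b}
            (λ r c → cong (A (suc (suc r))) (sym (punchIn-indexWithout-comm a b a≢b c))) =
  trans (regroup (altSign a) (altSign (indexWithout a b)) (A (suc zero) a) (A zero b) d)
  (trans (cong (λ z → z * (A (suc zero) a * A zero b * d)) (altSign-indexWithout a b a≢b))
         (regroup′ (altSign b) (altSign (indexWithout b a)) (A (suc zero) a) (A zero b) d))
  where d = det n (minor01 A a b)
        regroup : ∀ x y p q d → x * (p * (y * (q * d))) ≡ (x * y) * (p * q * d)
        regroup = solve-∀
        regroup′ : ∀ z w p q d → (- (z * w)) * (p * q * d) ≡ - (z * (q * (w * (p * d))))
        regroup′ = solve-∀

-- Swapping rows 0 and 1 exchanges the roles of a and b in the double sum.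
det-swapRows01 : ∀ n (A : Mat (suc (suc n))) →
  det (suc (suc n)) (λ r c → A (adjSwap zero r) c) ≡ - det (suc (suc n)) A
det-swapRows01 n A = begin
  det m B                                       ≡⟨ det-pairExpansion n B ⟩
  sumF m (λ a → sumF m (pairTerm B a))           ≡⟨ sumF-cong m (λ a → sumF-cong m (pairTerm-swapRows A a)) ⟩
  sumF m (λ a → sumF m (λ b → - pairTerm A b a)) ≡⟨ sumF-cong m (λ a → sumF-neg m (λ b → pairTerm A b a)) ⟩
  sumF m (λ a → - sumF m (λ b → pairTerm A b a)) ≡⟨ sumF-neg m (λ a → sumF m (λ b → pairTerm A b a)) ⟩
  - sumF m (λ a → sumF m (λ b → pairTerm A b a)) ≡⟨ cong -_ (sumF-comm m m (λ a b → pairTerm A b a)) ⟩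
  - sumF m (λ b → sumF m (pairTerm A b))         ≡⟨ cong -_ (sym (det-pairExpansion n A)) ⟩
  - det m A ∎
  where open ≡-Reasoning
        m = suc (suc n)
        B : Mat (suc (suc n))
        B r c = A (adjSwap zero r) c

det-adjSwapRows : ∀ n (j : Fin n) (A : Mat (suc n)) →
  det (suc n) (λ r c → A (adjSwap j r) c) ≡ - det (suc n) A
det-adjSwapRows (suc n)       zero    A = det-swapRows01 n A
det-adjSwapRows (suc (suc n)) (suc j) A = begin
  det m (λ r c → A (adjSwap (suc j) r) c)
    ≡⟨ det-expand (suc (suc n)) (λ r c → A (adjSwap (suc j) r) c) ⟩
  sumF m (λ c → altSign c * (A zero c * det (suc (suc n)) (λ r x → minor0 A c (adjSwap j r) x)))
    ≡⟨ sumF-cong m (λ c → cong (λ z → altSign c * (A zero c * z)) (det-adjSwapRows (suc n) j (minor0 A c))) ⟩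
  sumF m (λ c → altSign c * (A zero c * - det (suc (suc n)) (minor0 A c)))
    ≡⟨ sumF-cong m (λ c → pull-neg (altSign c) (A zero c) (det (suc (suc n)) (minor0 A c))) ⟩
  sumF m (λ c → - (altSign c * (A zero c * det (suc (suc n)) (minor0 A c))))
    ≡⟨ sumF-neg m (laplaceTerm A) ⟩
  - sumF m (λ c → altSign c * (A zero c * det (suc (suc n)) (minor0 A c)))
    ≡⟨ cong -_ (sym (det-expand (suc (suc n)) A)) ⟩
  - det m A ∎
  where open ≡-Reasoning
        m = suc (suc (suc n))
        pull-neg : ∀ x y z → x * (y * - z) ≡ - (x * (y * z))
        pull-neg = solve-∀

-- Either adjSwap j exchanges c with its neighbour, and then the two minors have the
-- same columns; or it fixes c, and then it acts on the minor as another adjacent swap.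
adjSwap-minorColumns : ∀ {n} (j : Fin (suc n)) (c : Fin (suc (suc n))) →
  (altSign (adjSwap j c) ≡ - altSign c × (∀ x → adjSwap j (punchIn (adjSwap j c) x) ≡ punchIn c x))
  ⊎ (adjSwap j c ≡ c × Σ (Fin n) (λ j′ → ∀ x → adjSwap j (punchIn c x) ≡ punchIn c (adjSwap j′ x)))
adjSwap-minorColumns zero zero = inj₁ (refl , columns)
  where columns : ∀ x → adjSwap zero (punchIn (suc zero) x) ≡ punchIn zero x
        columns zero    = refl
        columns (suc x) = refl
adjSwap-minorColumns zero (suc zero) = inj₁ (refl , columns)
  where columns : ∀ x → adjSwap zero (punchIn zero x) ≡ punchIn (suc zero) x
        columns zero    = refl
        columns (suc x) = refl
adjSwap-minorColumns {suc n} zero (suc (suc c)) = inj₂ (refl , zero , columns)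
  where columns : ∀ x → adjSwap zero (punchIn (suc (suc c)) x) ≡ punchIn (suc (suc c)) (adjSwap zero x)
        columns zero          = refl
        columns (suc zero)    = refl
        columns (suc (suc x)) = refl
adjSwap-minorColumns {suc n} (suc j) zero = inj₂ (refl , j , λ x → refl)
adjSwap-minorColumns {suc n} (suc j) (suc c) with adjSwap-minorColumns j c
... | inj₁ (sign , columns) = inj₁ (cong -_ sign , columns′)
  where columns′ : ∀ x → adjSwap (suc j) (punchIn (suc (adjSwap j c)) x) ≡ punchIn (suc c) x
        columns′ zero    = refl
        columns′ (suc x) = cong suc (columns x)
... | inj₂ (fixed , j′ , columns) = inj₂ (cong suc fixed , suc j′ , columns′)
  where columns′ : ∀ x → adjSwap (suc j) (punchIn (suc c) x) ≡ punchIn (suc c) (adjSwap (suc j′) x)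
        columns′ zero    = refl
        columns′ (suc x) = cong suc (columns x)

det-adjSwapCols : ∀ n (j : Fin n) (A : Mat (suc n)) →
  det (suc n) (λ r c → A r (adjSwap j c)) ≡ - det (suc n) A

signedMinor-adjSwapCols : ∀ n (j : Fin (suc n)) (A : Mat (suc (suc n))) c →
  altSign (adjSwap j c) * det (suc n) (minor0 (λ r c → A r (adjSwap j c)) (adjSwap j c))
    ≡ - (altSign c * det (suc n) (minor0 A c))
signedMinor-adjSwapCols n j A c with adjSwap-minorColumns j c
... | inj₁ (sign , columns) =
  trans (cong₂ _*_ sign (det-cong (suc n) (λ r x → cong (A (suc r)) (columns x))))
        (sym (ℤ.neg-distribˡ-* (altSign c) _))
... | inj₂ (fixed , j′ , columns) = begin
  altSign (adjSwap j c) * det (suc n) (minor0 B (adjSwap j c))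
    ≡⟨ cong (λ z → altSign z * det (suc n) (minor0 B z)) fixed ⟩
  altSign c * det (suc n) (minor0 B c)
    ≡⟨ cong (altSign c *_) (det-cong (suc n) (λ r x → cong (A (suc r)) (columns x))) ⟩
  altSign c * det (suc n) (λ r x → minor0 A c r (adjSwap j′ x))
    ≡⟨ cong (altSign c *_) (det-adjSwapCols n j′ (minor0 A c)) ⟩
  altSign c * - det (suc n) (minor0 A c)
    ≡⟨ sym (ℤ.neg-distribʳ-* (altSign c) _) ⟩
  - (altSign c * det (suc n) (minor0 A c)) ∎
  where open ≡-Reasoning
        B : Mat (suc (suc n))
        B r c = A r (adjSwap j c)

det-adjSwapCols (suc n) j A = begin
  det m B
    ≡⟨ det-expand (suc n) B ⟩
  sumF m (laplaceTerm B)
    ≡⟨ sym (sumF-adjSwap (suc n) j (laplaceTerm B)) ⟩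
  sumF m (λ c → laplaceTerm B (adjSwap j c))
    ≡⟨ sumF-cong m swappedTerm ⟩
  sumF m (λ c → - laplaceTerm A c)
    ≡⟨ sumF-neg m (laplaceTerm A) ⟩
  - sumF m (laplaceTerm A)
    ≡⟨ cong -_ (sym (det-expand (suc n) A)) ⟩
  - det m A ∎
  where
  open ≡-Reasoning
  m = suc (suc n)
  B : Mat (suc (suc n))
  B r c = A r (adjSwap j c)
  swappedTerm : ∀ c → laplaceTerm B (adjSwap j c) ≡ - laplaceTerm A c
  swappedTerm c rewrite adjSwap-involutive j c =
    trans (left-comm (altSign (adjSwap j c)) (A zero c) (det (suc n) (minor0 B (adjSwap j c))))
    (trans (cong (A zero c *_) (signedMinor-adjSwapCols n j A c))
           (push-neg (A zero c) (altSign c) (det (suc n) (minor0 A c))))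
    where left-comm : ∀ x y z → x * (y * z) ≡ y * (x * z)
          left-comm = solve-∀
          push-neg : ∀ y x z → y * - (x * z) ≡ - (x * (y * z))
          push-neg = solve-∀

det-adjSwap : ∀ n (j : Fin n) (A : Mat (suc n)) →
  det (suc n) (λ r c → A (adjSwap j r) (adjSwap j c)) ≡ det (suc n) A
det-adjSwap n j A = trans (det-adjSwapRows n j (λ r c → A r (adjSwap j c)))
  (trans (cong -_ (det-adjSwapCols n j A)) (ℤ.neg-involutive _))

applySwaps : ∀ {n} → List (Fin n) → Fin (suc n) → Fin (suc n)
applySwaps []      x = x
applySwaps (j ∷ w) x = adjSwap j (applySwaps w x)

det-applySwaps : ∀ n (w : List (Fin n)) (A : Mat (suc n)) →
  det (suc n) (λ r c → A (applySwaps w r) (applySwaps w c)) ≡ det (suc n) A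
det-applySwaps n []      A = refl
det-applySwaps n (j ∷ w) A =
  trans (det-applySwaps n w (λ r c → A (adjSwap j r) (adjSwap j c))) (det-adjSwap n j A)

applySwaps-++ : ∀ {n} (w₁ w₂ : List (Fin n)) x →
  applySwaps (w₁ ++ w₂) x ≡ applySwaps w₁ (applySwaps w₂ x)
applySwaps-++ []       w₂ x = refl
applySwaps-++ (j ∷ w₁) w₂ x = cong (adjSwap j) (applySwaps-++ w₁ w₂ x)

applySwaps-map-suc-zero : ∀ {n} (w : List (Fin n)) → applySwaps (map suc w) zero ≡ zero
applySwaps-map-suc-zero []      = refl
applySwaps-map-suc-zero (j ∷ w) rewrite applySwaps-map-suc-zero w = refl

applySwaps-map-suc-suc : ∀ {n} (w : List (Fin n)) x →
  applySwaps (map suc w) (suc x) ≡ suc (applySwaps w x)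
applySwaps-map-suc-suc []      x = refl
applySwaps-map-suc-suc (j ∷ w) x rewrite applySwaps-map-suc-suc w x = refl

moveToFront : ∀ {n} → Fin (suc n) → Fin (suc n) → Fin (suc n)
moveToFront t zero    = t
moveToFront t (suc x) = punchIn t x

moveToFrontSwaps : ∀ {n} → Fin (suc n) → List (Fin n)
moveToFrontSwaps zero            = []
moveToFrontSwaps {suc n} (suc t) = map suc (moveToFrontSwaps t) ++ (zero ∷ [])

moveToFront≡applySwaps : ∀ {n} (t : Fin (suc n)) x → moveToFront t x ≡ applySwaps (moveToFrontSwaps t) x
moveToFront≡applySwaps zero    zero    = refl
moveToFront≡applySwaps zero    (suc x) = refl
moveToFront≡applySwaps {suc n} (suc t) x =
  trans (swapFirst x) (sym (applySwaps-++ (map suc (moveToFrontSwaps t)) (zero ∷ []) x))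
  where
  swapFirst : ∀ x → moveToFront (suc t) x ≡ applySwaps (map suc (moveToFrontSwaps t)) (adjSwap zero x)
  swapFirst zero = trans (cong suc (moveToFront≡applySwaps t zero))
                         (sym (applySwaps-map-suc-suc (moveToFrontSwaps t) zero))
  swapFirst (suc zero) = sym (applySwaps-map-suc-zero (moveToFrontSwaps t))
  swapFirst (suc (suc x)) = trans (cong suc (moveToFront≡applySwaps t (suc x)))
                                  (sym (applySwaps-map-suc-suc (moveToFrontSwaps t) (suc x)))

det-moveToFront : ∀ n (t : Fin (suc n)) (A : Mat (suc n)) →
  det (suc n) (λ r c → A (moveToFront t r) (moveToFront t c)) ≡ det (suc n) A
det-moveToFront n t A =
  trans (det-cong (suc n) (λ r c → cong₂ A (moveToFront≡applySwaps t r) (moveToFront≡applySwaps t c)))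
        (det-applySwaps n (moveToFrontSwaps t) A)

permutation⇒swaps : ∀ n (π : Permutation′ (suc n)) →
  Σ (List (Fin n)) (λ w → ∀ x → π ⟨$⟩ʳ x ≡ applySwaps w x)
permutation⇒swaps zero π = [] , fixes
  where fixes : ∀ x → π ⟨$⟩ʳ x ≡ x
        fixes zero with π ⟨$⟩ʳ zero
        ... | zero = refl
permutation⇒swaps (suc n) π with permutation⇒swaps n (remove zero π)
... | w , π′≡w = (moveToFrontSwaps t ++ map suc w) , π≡
  where
  t = π ⟨$⟩ʳ zero
  π≡ : ∀ x → π ⟨$⟩ʳ x ≡ applySwaps (moveToFrontSwaps t ++ map suc w) x
  π≡ zero = trans (moveToFront≡applySwaps t zero)
    (trans (cong (applySwaps (moveToFrontSwaps t)) (sym (applySwaps-map-suc-zero w)))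
           (sym (applySwaps-++ (moveToFrontSwaps t) (map suc w) zero)))
  π≡ (suc x) = trans (sym (Fin.punchIn-punchOut _))
    (trans (cong (punchIn t) (π′≡w x))
    (trans (moveToFront≡applySwaps t (suc (applySwaps w x)))
    (trans (cong (applySwaps (moveToFrontSwaps t)) (sym (applySwaps-map-suc-suc w x)))
           (sym (applySwaps-++ (moveToFrontSwaps t) (map suc w) (suc x))))))

det-permute : ∀ n (π : Permutation′ n) (A : Mat n) →
  det n (λ a b → A (π ⟨$⟩ʳ a) (π ⟨$⟩ʳ b)) ≡ det n A
det-permute zero    π A = refl
det-permute (suc n) π A with permutation⇒swaps n π
... | w , π≡w = trans (det-cong (suc n) (λ a b → cong₂ A (π≡w a) (π≡w b))) (det-applySwaps n w A)

det-reindexFin : ∀ M N (e : Fin M ↔ Fin N) (A : Mat N) →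
  det M (λ a b → A (Inverse.to e a) (Inverse.to e b)) ≡ det N A
det-reindexFin M N e A with ↔⇒≡ e
... | refl = det-permute M e A

det-reindex : ∀ {X : Set} M N (e₁ : Fin M ↔ X) (e₂ : Fin N ↔ X) (A : X → X → ℤ) →
  det M (λ a b → A (Inverse.to e₁ a) (Inverse.to e₁ b)) ≡ det N (λ a b → A (Inverse.to e₂ a) (Inverse.to e₂ b))
det-reindex M N e₁ e₂ A =
  trans (det-cong M (λ a b → sym (cong₂ A (Inverse.strictlyInverseˡ e₂ (Inverse.to e₁ a))
                                          (Inverse.strictlyInverseˡ e₂ (Inverse.to e₁ b)))))
        (det-reindexFin M N (↔-sym e₂ ↔-∘ e₁) (λ a b → A (Inverse.to e₂ a) (Inverse.to e₂ b)))

altSign-↑ˡ : ∀ {a} b (j : Fin a) → altSign (j ↑ˡ b) ≡ altSign j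
altSign-↑ˡ b zero    = refl
altSign-↑ˡ b (suc j) = cong -_ (altSign-↑ˡ b j)

punchIn-↑ˡ : ∀ {a} b (j : Fin (suc a)) (k : Fin a) → punchIn (j ↑ˡ b) (k ↑ˡ b) ≡ punchIn j k ↑ˡ b
punchIn-↑ˡ b zero    k       = refl
punchIn-↑ˡ b (suc j) zero    = refl
punchIn-↑ˡ b (suc j) (suc k) = cong suc (punchIn-↑ˡ b j k)

punchIn-↑ʳ : ∀ {a} b (j : Fin (suc a)) (k : Fin b) → punchIn (j ↑ˡ b) (a ↑ʳ k) ≡ suc a ↑ʳ k
punchIn-↑ʳ         b zero    k = refl
punchIn-↑ʳ {suc a} b (suc j) k = cong suc (punchIn-↑ʳ b j k)

det-blockTriangular : ∀ a b (A : Mat (a ℕ.+ b)) → (∀ i j → A (i ↑ˡ b) (a ↑ʳ j) ≡ 0ℤ) →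
  det (a ℕ.+ b) A ≡ det a (λ i j → A (i ↑ˡ b) (j ↑ˡ b)) * det b (λ i j → A (a ↑ʳ i) (a ↑ʳ j))
det-blockTriangular zero    b A upper≡0 = sym (ℤ.*-identityˡ _)
det-blockTriangular (suc a) b A upper≡0 = begin
  det (suc a ℕ.+ b) A
    ≡⟨ det-expand (a ℕ.+ b) A ⟩
  sumF (suc a ℕ.+ b) (laplaceTerm A)
    ≡⟨ sumF-↑ˡ (suc a) b (laplaceTerm A) upperTerm≡0 ⟩
  sumF (suc a) (λ j → laplaceTerm A (j ↑ˡ b))
    ≡⟨ sumF-cong (suc a) leftTerm ⟩
  sumF (suc a) (λ j → laplaceTerm P j * det b Q)
    ≡⟨ sumF-*ʳ (suc a) (det b Q) (laplaceTerm P) ⟩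
  sumF (suc a) (laplaceTerm P) * det b Q
    ≡⟨ cong (_* det b Q) (sym (det-expand a P)) ⟩
  det (suc a) P * det b Q ∎
  where
  open ≡-Reasoning
  P : Mat (suc a)
  P i j = A (i ↑ˡ b) (j ↑ˡ b)
  Q : Mat b
  Q i j = A (suc a ↑ʳ i) (suc a ↑ʳ j)
  upperTerm≡0 : ∀ j → laplaceTerm A (suc a ↑ʳ j) ≡ 0ℤ
  upperTerm≡0 j rewrite upper≡0 zero j = ℤ.*-zeroʳ (altSign (suc a ↑ʳ j))
  leftTerm : ∀ j → laplaceTerm A (j ↑ˡ b) ≡ laplaceTerm P j * det b Q
  leftTerm j = trans
    (cong₂ (λ s d → s * (A zero (j ↑ˡ b) * d)) (altSign-↑ˡ b j)
      (trans (det-blockTriangular a b (minor0 A (j ↑ˡ b))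
                (λ i k → trans (cong (A (suc (i ↑ˡ b))) (punchIn-↑ʳ b j k)) (upper≡0 (suc i) k)))
             (cong₂ _*_ (det-cong a (λ r c → cong (A (suc (r ↑ˡ b))) (punchIn-↑ˡ b j c)))
                        (det-cong b (λ r c → cong (A (suc (a ↑ʳ r))) (punchIn-↑ʳ b j c))))))
    (assoc (altSign j) (A zero (j ↑ˡ b)) (det a (minor0 P j)) (det b Q))
    where assoc : ∀ x y z w → x * (y * (z * w)) ≡ x * (y * z) * w
          assoc = solve-∀

withFirstRow : ∀ {n} → (Fin (suc n) → ℤ) → Mat (suc n) → Mat (suc n)
withFirstRow f A zero    c = f c
withFirstRow f A (suc r) c = A (suc r) c

det-withFirstRow-+ : ∀ n (f g : Fin (suc n) → ℤ) (A : Mat (suc n)) →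
  det (suc n) (withFirstRow (λ c → f c + g c) A)
    ≡ det (suc n) (withFirstRow f A) + det (suc n) (withFirstRow g A)
det-withFirstRow-+ n f g A = begin
  det (suc n) (withFirstRow (λ c → f c + g c) A)
    ≡⟨ det-expand n (withFirstRow (λ c → f c + g c) A) ⟩
  sumF (suc n) (laplaceTerm (withFirstRow (λ c → f c + g c) A))
    ≡⟨ sumF-cong (suc n) (λ j → distrib (altSign j) (f j) (g j) (det n (minor0 A j))) ⟩
  sumF (suc n) (λ j → laplaceTerm (withFirstRow f A) j + laplaceTerm (withFirstRow g A) j)
    ≡⟨ sumF-+ (suc n) (laplaceTerm (withFirstRow f A)) (laplaceTerm (withFirstRow g A)) ⟩
  sumF (suc n) (laplaceTerm (withFirstRow f A)) + sumF (suc n) (laplaceTerm (withFirstRow g A))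
    ≡⟨ sym (cong₂ _+_ (det-expand n (withFirstRow f A)) (det-expand n (withFirstRow g A))) ⟩
  det (suc n) (withFirstRow f A) + det (suc n) (withFirstRow g A) ∎
  where open ≡-Reasoning
        distrib : ∀ s x y d → s * ((x + y) * d) ≡ s * (x * d) + s * (y * d)
        distrib = solve-∀

cutVertexʳ : ∀ p q → Fin (suc q) → Fin (suc (p ℕ.+ q))
cutVertexʳ p q zero    = zero
cutVertexʳ p q (suc z) = suc (p ↑ʳ z)

swapBlocks : ∀ p q → Fin (suc (q ℕ.+ p)) ↔ Fin (suc (p ℕ.+ q))
swapBlocks p q = lift₀ (↔-sym (Fin.+↔⊎ {p} {q}) ↔-∘ (⊎-comm (Fin q) (Fin p) ↔-∘ Fin.+↔⊎ {q} {p}))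

det-cutVertexˡ : ∀ p q (A : Mat (suc (p ℕ.+ q))) →
  (∀ z → A zero (suc (p ↑ʳ z)) ≡ 0ℤ) → (∀ y z → A (suc (y ↑ˡ q)) (suc (p ↑ʳ z)) ≡ 0ℤ) →
  det (suc (p ℕ.+ q)) A ≡
    det (suc p) (λ i j → A (i ↑ˡ q) (j ↑ˡ q)) * det q (λ i j → A (suc (p ↑ʳ i)) (suc (p ↑ʳ j)))
det-cutVertexˡ p q A vZ≡0 YZ≡0 = det-blockTriangular (suc p) q A upper≡0
  where upper≡0 : ∀ i j → A (i ↑ˡ q) (suc p ↑ʳ j) ≡ 0ℤ
        upper≡0 zero    j = vZ≡0 j
        upper≡0 (suc y) j = YZ≡0 y j

det-cutVertexʳ : ∀ p q (A : Mat (suc (p ℕ.+ q))) →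
  (∀ y → A zero (suc (y ↑ˡ q)) ≡ 0ℤ) → (∀ z y → A (suc (p ↑ʳ z)) (suc (y ↑ˡ q)) ≡ 0ℤ) →
  det (suc (p ℕ.+ q)) A ≡
    det (suc q) (λ i j → A (cutVertexʳ p q i) (cutVertexʳ p q j)) * det p (λ i j → A (suc (i ↑ˡ q)) (suc (j ↑ˡ q)))
det-cutVertexʳ p q A vY≡0 ZY≡0 =
  trans (sym (det-reindexFin (suc (q ℕ.+ p)) (suc (p ℕ.+ q)) e A))
        (trans (det-blockTriangular (suc q) p B upper≡0) (cong₂ _*_ (det-cong (suc q) blockZ) (det-cong p blockY)))
  where
  e = swapBlocks p q
  B : Mat (suc (q ℕ.+ p))
  B a b = A (Inverse.to e a) (Inverse.to e b)
  to-Z : ∀ i → Inverse.to e (i ↑ˡ p) ≡ cutVertexʳ p q i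
  to-Z zero    = refl
  to-Z (suc z) rewrite Fin.splitAt-↑ˡ q z p = refl
  to-Y : ∀ y → Inverse.to e (suc q ↑ʳ y) ≡ suc (y ↑ˡ q)
  to-Y y rewrite Fin.splitAt-↑ʳ q p y = refl
  upper≡0 : ∀ i j → B (i ↑ˡ p) (suc q ↑ʳ j) ≡ 0ℤ
  upper≡0 i j rewrite to-Z i | to-Y j with i
  ... | zero  = vY≡0 j
  ... | suc z = ZY≡0 z j
  blockZ : ∀ i j → B (i ↑ˡ p) (j ↑ˡ p) ≡ A (cutVertexʳ p q i) (cutVertexʳ p q j)
  blockZ i j rewrite to-Z i | to-Z j = refl
  blockY : ∀ i j → B (suc q ↑ʳ i) (suc q ↑ʳ j) ≡ A (suc (i ↑ˡ q)) (suc (j ↑ˡ q))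
  blockY i j rewrite to-Y i | to-Y j = refl

-- Split the first row into its Y- and Z-parts; A₀₀ = 0 lets it go to neither.
det-cutVertex : ∀ p q (A : Mat (suc (p ℕ.+ q))) → A zero zero ≡ 0ℤ →
  (∀ y z → A (suc (y ↑ˡ q)) (suc (p ↑ʳ z)) ≡ 0ℤ) →
  (∀ z y → A (suc (p ↑ʳ z)) (suc (y ↑ˡ q)) ≡ 0ℤ) →
  det (suc (p ℕ.+ q)) A ≡
    det (suc p) (λ i j → A (i ↑ˡ q) (j ↑ˡ q)) * det q (λ i j → A (suc (p ↑ʳ i)) (suc (p ↑ʳ j)))
    + det p (λ i j → A (suc (i ↑ˡ q)) (suc (j ↑ˡ q))) * det (suc q) (λ i j → A (cutVertexʳ p q i) (cutVertexʳ p q j))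
det-cutVertex p q A A00≡0 YZ≡0 ZY≡0 = begin
  det (suc (p ℕ.+ q)) A
    ≡⟨ det-cong (suc (p ℕ.+ q)) firstRow-split ⟩
  det (suc (p ℕ.+ q)) (withFirstRow (λ c → rowY c + rowZ c) A)
    ≡⟨ det-withFirstRow-+ (p ℕ.+ q) rowY rowZ A ⟩
  det (suc (p ℕ.+ q)) (withFirstRow rowY A) + det (suc (p ℕ.+ q)) (withFirstRow rowZ A)
    ≡⟨ cong₂ _+_ det-rowY (trans det-rowZ (ℤ.*-comm (det (suc q) VZ) (det p YY))) ⟩
  det (suc p) VY * det q ZZ + det p YY * det (suc q) VZ ∎
  where
  open ≡-Reasoning
  VY : Mat (suc p)
  VY i j = A (i ↑ˡ q) (j ↑ˡ q)
  YY : Mat p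
  YY i j = A (suc (i ↑ˡ q)) (suc (j ↑ˡ q))
  ZZ : Mat q
  ZZ i j = A (suc (p ↑ʳ i)) (suc (p ↑ʳ j))
  VZ : Mat (suc q)
  VZ i j = A (cutVertexʳ p q i) (cutVertexʳ p q j)
  rowY rowZ : Fin (suc (p ℕ.+ q)) → ℤ
  rowY c = [ (λ _ → A zero c) , (λ _ → 0ℤ) ]′ (splitAt (suc p) c)
  rowZ c = [ (λ _ → 0ℤ) , (λ _ → A zero c) ]′ (splitAt (suc p) c)
  firstRow-split : ∀ r c → A r c ≡ withFirstRow (λ c → rowY c + rowZ c) A r c
  firstRow-split zero c with splitAt (suc p) c
  ... | inj₁ _ = sym (ℤ.+-identityʳ _)
  ... | inj₂ _ = sym (ℤ.+-identityˡ _)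
  firstRow-split (suc r) c = refl
  det-rowY : det (suc (p ℕ.+ q)) (withFirstRow rowY A) ≡ det (suc p) VY * det q ZZ
  det-rowY = trans (det-cutVertexˡ p q (withFirstRow rowY A) rowY-Z≡0 YZ≡0)
                   (cong (_* det q ZZ) (det-cong (suc p) sameVY))
    where
    rowY-Z≡0 : ∀ z → rowY (suc (p ↑ʳ z)) ≡ 0ℤ
    rowY-Z≡0 z rewrite Fin.splitAt-↑ʳ (suc p) q z = refl
    sameVY : ∀ i j → withFirstRow rowY A (i ↑ˡ q) (j ↑ˡ q) ≡ VY i j
    sameVY zero    j rewrite Fin.splitAt-↑ˡ (suc p) j q = refl
    sameVY (suc i) j = refl
  det-rowZ : det (suc (p ℕ.+ q)) (withFirstRow rowZ A) ≡ det (suc q) VZ * det p YY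
  det-rowZ = trans (det-cutVertexʳ p q (withFirstRow rowZ A) rowZ-Y≡0 ZY≡0)
                   (cong (_* det p YY) (det-cong (suc q) sameVZ))
    where
    rowZ-Y≡0 : ∀ y → rowZ (suc (y ↑ˡ q)) ≡ 0ℤ
    rowZ-Y≡0 y rewrite Fin.splitAt-↑ˡ (suc p) (suc y) q = refl
    sameVZ : ∀ i j → withFirstRow rowZ A (cutVertexʳ p q i) (cutVertexʳ p q j) ≡ VZ i j
    sameVZ zero    zero    = sym A00≡0
    sameVZ zero    (suc z) rewrite Fin.splitAt-↑ʳ (suc p) q z = refl
    sameVZ (suc i) j       = refl


-- Forests and stars of trees

TreeVertex : ∀ k → (Fin k → ℕ) → Set
TreeVertex k m = Σ (Fin k) (λ i → Fin (m i))

treeVertex : ∀ k (m : Fin k → ℕ) → Fin (sumℕ k m) → TreeVertex k m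
treeVertex (suc k) m x =
  [ (zero ,_) , (λ b → Σ.map suc id (treeVertex k (λ i → m (suc i)) b)) ]′ (splitAt (m zero) x)

treeIndex : ∀ k (m : Fin k → ℕ) → TreeVertex k m → Fin (sumℕ k m)
treeIndex (suc k) m (zero  , a) = a ↑ˡ sumℕ k (λ i → m (suc i))
treeIndex (suc k) m (suc i , y) = m zero ↑ʳ treeIndex k (λ i → m (suc i)) (i , y)

treeVertex-↑ˡ : ∀ k (m : Fin (suc k) → ℕ) a →
  treeVertex (suc k) m (a ↑ˡ sumℕ k (λ i → m (suc i))) ≡ (zero , a)
treeVertex-↑ˡ k m a rewrite Fin.splitAt-↑ˡ (m zero) a (sumℕ k (λ i → m (suc i))) = refl

treeVertex-↑ʳ : ∀ k (m : Fin (suc k) → ℕ) b →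
  treeVertex (suc k) m (m zero ↑ʳ b) ≡ Σ.map suc id (treeVertex k (λ i → m (suc i)) b)
treeVertex-↑ʳ k m b rewrite Fin.splitAt-↑ʳ (m zero) (sumℕ k (λ i → m (suc i))) b = refl

treeVertex-treeIndex : ∀ k m t → treeVertex k m (treeIndex k m t) ≡ t
treeVertex-treeIndex (suc k) m (zero  , a) = treeVertex-↑ˡ k m a
treeVertex-treeIndex (suc k) m (suc i , y) =
  trans (treeVertex-↑ʳ k m _)
        (cong (Σ.map suc id) (treeVertex-treeIndex k (λ i → m (suc i)) (i , y)))

treeIndex-treeVertex : ∀ k m x → treeIndex k m (treeVertex k m x) ≡ x
treeIndex-treeVertex (suc k) m x with splitAt (m zero) x in eq
... | inj₁ a = Fin.splitAt⁻¹-↑ˡ eq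
... | inj₂ b = trans (cong (m zero ↑ʳ_) (treeIndex-treeVertex k (λ i → m (suc i)) b))
                    (Fin.splitAt⁻¹-↑ʳ eq)

treeBlock-suc : ∀ {k} {m : Fin (suc k) → ℕ} (T : (i : Fin (suc k)) → Mat (m i)) i x j y →
  treeBlock T (suc i) x (suc j) y ≡ treeBlock (λ i → T (suc i)) i x j y
treeBlock-suc T i x j y with i ≟ j
... | yes refl = refl
... | no _     = refl

forestMat : ∀ k (m : Fin k → ℕ) → ((i : Fin k) → Mat (m i)) → Mat (sumℕ k m)
forestMat k m T a b = treeBlock T (proj₁ (treeVertex k m a)) (proj₂ (treeVertex k m a))
                                  (proj₁ (treeVertex k m b)) (proj₂ (treeVertex k m b))

forestMat-suc : ∀ k (m : Fin (suc k) → ℕ) (T : (i : Fin (suc k)) → Mat (m i)) a b →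
  forestMat (suc k) m T (m zero ↑ʳ a) (m zero ↑ʳ b) ≡ forestMat k (λ i → m (suc i)) (λ i → T (suc i)) a b
forestMat-suc k m T a b rewrite treeVertex-↑ʳ k m a | treeVertex-↑ʳ k m b =
  treeBlock-suc T (proj₁ (treeVertex k (λ i → m (suc i)) a)) (proj₂ (treeVertex k (λ i → m (suc i)) a))
                  (proj₁ (treeVertex k (λ i → m (suc i)) b)) (proj₂ (treeVertex k (λ i → m (suc i)) b))

det-forestMat : ∀ k m T → det (sumℕ k m) (forestMat k m T) ≡ prodF k (λ i → det (m i) (T i))
det-forestMat zero    m T = refl
det-forestMat (suc k) m T =
  trans (det-blockTriangular (m zero) rest (forestMat (suc k) m T) upper≡0)
        (cong₂ _*_ (det-cong (m zero) firstTree)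
                   (trans (det-cong rest (forestMat-suc k m T))
                          (det-forestMat k (λ i → m (suc i)) (λ i → T (suc i)))))
  where
  rest = sumℕ k (λ i → m (suc i))
  upper≡0 : ∀ i j → forestMat (suc k) m T (i ↑ˡ rest) (m zero ↑ʳ j) ≡ 0ℤ
  upper≡0 i j rewrite treeVertex-↑ˡ k m i | treeVertex-↑ʳ k m j = refl
  firstTree : ∀ i j → forestMat (suc k) m T (i ↑ˡ rest) (j ↑ˡ rest) ≡ T zero i j
  firstTree i j rewrite treeVertex-↑ˡ k m i | treeVertex-↑ˡ k m j = refl

rootWeight : ∀ {k} {m : Fin k → ℕ} → ((i : Fin k) → Fin (m i)) → (Fin k → ℤ) → TreeVertex k m → ℤ
rootWeight r w (i , x) = if does (x ≟ r i) then w i else 0ℤ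

starMat : ∀ k (m : Fin k → ℕ) → ((i : Fin k) → Mat (m i)) →
  ((i : Fin k) → Fin (m i)) → (Fin k → ℤ) → Mat (suc (sumℕ k m))
starMat k m T r w zero    zero    = 0ℤ
starMat k m T r w zero    (suc b) = rootWeight r w (treeVertex k m b)
starMat k m T r w (suc a) zero    = rootWeight r w (treeVertex k m a)
starMat k m T r w (suc a) (suc b) = forestMat k m T a b

starSum : ∀ k (m : Fin k → ℕ) → ((i : Fin k) → Mat (m i)) →
  ((i : Fin k) → Fin (m i)) → (Fin k → ℤ) → ℤ
starSum k m T r w = sumF k (λ i → det (suc (m i)) (withVertex (T i) (r i) (w i))
                                  * prodF k (λ j → if does (j ≟ i) then 1ℤ else det (m j) (T j)))

does-≟-suc : ∀ {k} (i j : Fin k) → does (suc j ≟ suc i) ≡ does (j ≟ i)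
does-≟-suc i j with j ≟ i
... | yes _ = refl
... | no _  = refl

starSum-suc : ∀ k m T r w →
  starSum (suc k) m T r w
    ≡ det (suc (m zero)) (withVertex (T zero) (r zero) (w zero)) * prodF k (λ i → det (m (suc i)) (T (suc i)))
      + det (m zero) (T zero) * starSum k (λ i → m (suc i)) (λ i → T (suc i)) (λ i → r (suc i)) (λ i → w (suc i))
starSum-suc k m T r w = cong₂ _+_ (cong (W zero *_) (ℤ.*-identityˡ _)) (begin
  sumF k (λ i → W (suc i) * (D zero * prodF k (λ j → if does (suc j ≟ suc i) then 1ℤ else D (suc j))))
    ≡⟨ sumF-cong k (λ i → cong (λ z → W (suc i) * (D zero * z))
         (prodF-cong k (λ j → cong (λ b → if b then 1ℤ else D (suc j)) (does-≟-suc i j)))) ⟩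
  sumF k (λ i → W (suc i) * (D zero * P i))
    ≡⟨ sumF-cong k (λ i → left-comm (W (suc i)) (D zero) (P i)) ⟩
  sumF k (λ i → D zero * (W (suc i) * P i))
    ≡⟨ sumF-*ˡ k (D zero) (λ i → W (suc i) * P i) ⟩
  D zero * sumF k (λ i → W (suc i) * P i) ∎)
  where
  open ≡-Reasoning
  W = λ i → det (suc (m i)) (withVertex (T i) (r i) (w i))
  D = λ i → det (m i) (T i)
  P = λ i → prodF k (λ j → if does (j ≟ i) then 1ℤ else D (suc j))
  left-comm : ∀ x y z → x * (y * z) ≡ y * (x * z)
  left-comm = solve-∀

det-starMat-suc : ∀ k (m : Fin (suc k) → ℕ) T r w →
  det (suc (sumℕ (suc k) m)) (starMat (suc k) m T r w)
    ≡ det (suc (m zero)) (withVertex (T zero) (r zero) (w zero))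
        * det (sumℕ k (λ i → m (suc i))) (forestMat k (λ i → m (suc i)) (λ i → T (suc i)))
      + det (m zero) (T zero)
        * det (suc (sumℕ k (λ i → m (suc i))))
              (starMat k (λ i → m (suc i)) (λ i → T (suc i)) (λ i → r (suc i)) (λ i → w (suc i)))
det-starMat-suc k m T r w =
  trans (det-cutVertex (m zero) rest S refl YZ≡0 ZY≡0)
        (cong₂ _+_ (cong₂ _*_ (det-cong (suc (m zero)) firstStar) (det-cong rest (forestMat-suc k m T)))
                   (cong₂ _*_ (det-cong (m zero) firstTree) (det-cong (suc rest) otherStar)))
  where
  rest = sumℕ k (λ i → m (suc i))
  S = starMat (suc k) m T r w
  YZ≡0 : ∀ y z → S (suc (y ↑ˡ rest)) (suc (m zero ↑ʳ z)) ≡ 0ℤ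
  YZ≡0 y z rewrite treeVertex-↑ˡ k m y | treeVertex-↑ʳ k m z = refl
  ZY≡0 : ∀ z y → S (suc (m zero ↑ʳ z)) (suc (y ↑ˡ rest)) ≡ 0ℤ
  ZY≡0 z y rewrite treeVertex-↑ˡ k m y | treeVertex-↑ʳ k m z = refl
  firstStar : ∀ i j → S (i ↑ˡ rest) (j ↑ˡ rest) ≡ withVertex (T zero) (r zero) (w zero) i j
  firstStar zero    zero    = refl
  firstStar zero    (suc j) rewrite treeVertex-↑ˡ k m j = refl
  firstStar (suc i) zero    rewrite treeVertex-↑ˡ k m i = refl
  firstStar (suc i) (suc j) rewrite treeVertex-↑ˡ k m i | treeVertex-↑ˡ k m j = refl
  firstTree : ∀ i j → S (suc (i ↑ˡ rest)) (suc (j ↑ˡ rest)) ≡ T zero i j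
  firstTree i j rewrite treeVertex-↑ˡ k m i | treeVertex-↑ˡ k m j = refl
  otherStar : ∀ i j → S (cutVertexʳ (m zero) rest i) (cutVertexʳ (m zero) rest j)
                      ≡ starMat k (λ i → m (suc i)) (λ i → T (suc i)) (λ i → r (suc i)) (λ i → w (suc i)) i j
  otherStar zero    zero    = refl
  otherStar zero    (suc j) rewrite treeVertex-↑ʳ k m j = refl
  otherStar (suc i) zero    rewrite treeVertex-↑ʳ k m i = refl
  otherStar (suc i) (suc j) = forestMat-suc k m T i j

det-starMat : ∀ k m T r w → det (suc (sumℕ k m)) (starMat k m T r w) ≡ starSum k m T r w
det-starMat zero    m T r w = refl
det-starMat (suc k) m T r w =
  trans (det-starMat-suc k m T r w)
  (trans (cong₂ (λ x y → det (suc (m zero)) (withVertex (T zero) (r zero) (w zero)) * x + det (m zero) (T zero) * y)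
                (det-forestMat k m′ T′) (det-starMat k m′ T′ r′ w′))
         (sym (starSum-suc k m T r w)))
  where m′ = λ i → m (suc i)
        T′ = λ i → T (suc i)
        r′ = λ i → r (suc i)
        w′ = λ i → w (suc i)

suc-%-≢ : ∀ n (i : Fin (suc (suc n))) → ¬ (suc (toℕ i) % suc (suc n) ≡ toℕ i)
suc-%-≢ n i eq with ℕ.m≤n⇒m<n∨m≡n (Fin.toℕ<n i)
... | inj₁ 1+i<n = ℕ.1+n≢n (trans (sym (m<n⇒m%n≡m 1+i<n)) eq)
... | inj₂ 1+i≡n = ℕ.0≢1+n (trans (trans (sym (n%n≡0 (suc (suc n)))) (trans (sym (cong (_% suc (suc n)) 1+i≡n)) eq))
                                   (ℕ.suc-injective 1+i≡n))

cycleMat-diag : ∀ n (s : Fin (suc (suc n)) → ℤ) i → cycleMat (suc (suc n)) s i i ≡ 0ℤ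
cycleMat-diag n s i with suc (toℕ i) % suc (suc n) ℕ.≟ toℕ i
... | yes eq = ⊥-elim (suc-%-≢ n i eq)
... | no _ with suc (toℕ i) % suc (suc n) ℕ.≟ toℕ i
...   | yes eq = ⊥-elim (suc-%-≢ n i eq)
...   | no _   = refl

module Layout (n : ℕ) (v : Fin (suc n)) (k : ℕ) (m : Fin k → ℕ) where

  layout : Fin (suc (sumℕ k m ℕ.+ n)) → UVertex (suc n) k m
  layout zero    = inj₁ v
  layout (suc x) = [ (λ t → inj₂ (treeVertex k m t)) , (λ c → inj₁ (punchIn v c)) ]′ (splitAt (sumℕ k m) x)

  layoutIndex : UVertex (suc n) k m → Fin (suc (sumℕ k m ℕ.+ n))
  layoutIndex (inj₁ a) with v ≟ a
  ... | yes _   = zero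
  ... | no v≢a  = suc (sumℕ k m ↑ʳ punchOut v≢a)
  layoutIndex (inj₂ t) = suc (treeIndex k m t ↑ˡ n)

  layout-layoutIndex : ∀ y → layout (layoutIndex y) ≡ y
  layout-layoutIndex (inj₁ a) with v ≟ a
  ... | yes v≡a = cong inj₁ v≡a
  ... | no v≢a rewrite Fin.splitAt-↑ʳ (sumℕ k m) n (punchOut v≢a) = cong inj₁ (Fin.punchIn-punchOut v≢a)
  layout-layoutIndex (inj₂ t) rewrite Fin.splitAt-↑ˡ (sumℕ k m) (treeIndex k m t) n =
    cong inj₂ (treeVertex-treeIndex k m t)

  layoutIndex-layout : ∀ x → layoutIndex (layout x) ≡ x
  layoutIndex-layout zero with v ≟ v
  ... | yes _  = refl
  ... | no v≢v = ⊥-elim (v≢v refl)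
  layoutIndex-layout (suc x) with splitAt (sumℕ k m) x in eq
  ... | inj₁ t = cong suc (trans (cong (_↑ˡ n) (treeIndex-treeVertex k m t)) (Fin.splitAt⁻¹-↑ˡ eq))
  ... | inj₂ c with v ≟ punchIn v c
  ...   | yes v≡ = ⊥-elim (Fin.punchInᵢ≢i v c (sym v≡))
  ...   | no v≢  = cong suc (trans (cong (sumℕ k m ↑ʳ_) (trans (Fin.punchOut-cong v refl) (Fin.punchOut-punchIn v)))
                                   (Fin.splitAt⁻¹-↑ʳ eq))

  layout↔ : Fin (suc (sumℕ k m ℕ.+ n)) ↔ UVertex (suc n) k m
  layout↔ = mk↔ₛ′ layout layoutIndex layout-layoutIndex layoutIndex-layout

module UnicyclicBlocks (n : ℕ) (s : Fin (suc (suc n)) → ℤ) (v : Fin (suc (suc n)))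
              (k : ℕ) (m : Fin k → ℕ) (T : (i : Fin k) → Mat (m i))
              (r : (i : Fin k) → Fin (m i)) (w : Fin k → ℤ) where

  open Layout (suc n) v k m public

  C = cycleMat (suc (suc n)) s
  S = sumℕ k m

  M : Mat (suc (S ℕ.+ suc n))
  M a b = UMat (suc (suc n)) k m C T r w v (layout a) (layout b)

  joinWeight-v : ∀ i x → joinWeight v r w v i x ≡ rootWeight r w (i , x)
  joinWeight-v i x with v ≟ v | x ≟ r i
  ... | yes _  | yes _ = refl
  ... | yes _  | no _  = refl
  ... | no v≢v | _     = ⊥-elim (v≢v refl)

  joinWeight-≢v : ∀ a → ¬ a ≡ v → ∀ i x → joinWeight v r w a i x ≡ 0ℤ
  joinWeight-≢v a a≢v i x with a ≟ v | x ≟ r i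
  ... | yes a≡v | _     = ⊥-elim (a≢v a≡v)
  ... | no _    | yes _ = refl
  ... | no _    | no _  = refl

  M-vv≡0 : M zero zero ≡ 0ℤ
  M-vv≡0 = cycleMat-diag n s v

  M-trees-cycle≡0 : ∀ y z → M (suc (y ↑ˡ suc n)) (suc (S ↑ʳ z)) ≡ 0ℤ
  M-trees-cycle≡0 y z rewrite Fin.splitAt-↑ˡ S y (suc n) | Fin.splitAt-↑ʳ S (suc n) z =
    joinWeight-≢v (punchIn v z) (Fin.punchInᵢ≢i v z) (proj₁ (treeVertex k m y)) (proj₂ (treeVertex k m y))

  M-cycle-trees≡0 : ∀ z y → M (suc (S ↑ʳ z)) (suc (y ↑ˡ suc n)) ≡ 0ℤ
  M-cycle-trees≡0 z y rewrite Fin.splitAt-↑ˡ S y (suc n) | Fin.splitAt-↑ʳ S (suc n) z =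
    joinWeight-≢v (punchIn v z) (Fin.punchInᵢ≢i v z) (proj₁ (treeVertex k m y)) (proj₂ (treeVertex k m y))

  det-starBlock : det (suc S) (λ i j → M (i ↑ˡ suc n) (j ↑ˡ suc n)) ≡ starSum k m T r w
  det-starBlock = trans (det-cong (suc S) starBlock) (det-starMat k m T r w)
    where
    starBlock : ∀ i j → M (i ↑ˡ suc n) (j ↑ˡ suc n) ≡ starMat k m T r w i j
    starBlock zero    zero    = M-vv≡0
    starBlock zero    (suc t) rewrite Fin.splitAt-↑ˡ S t (suc n) =
      joinWeight-v (proj₁ (treeVertex k m t)) (proj₂ (treeVertex k m t))
    starBlock (suc t) zero    rewrite Fin.splitAt-↑ˡ S t (suc n) =
      joinWeight-v (proj₁ (treeVertex k m t)) (proj₂ (treeVertex k m t))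
    starBlock (suc t) (suc u) rewrite Fin.splitAt-↑ˡ S t (suc n) | Fin.splitAt-↑ˡ S u (suc n) = refl

  det-pathBlock : det (suc n) (λ i j → M (suc (S ↑ʳ i)) (suc (S ↑ʳ j)))
                            ≡ deleteDet (suc (suc n)) C v
  det-pathBlock = det-cong (suc n) cycleBlock
    where
    cycleBlock : ∀ i j → M (suc (S ↑ʳ i)) (suc (S ↑ʳ j)) ≡ deleteVertex C v i j
    cycleBlock i j rewrite Fin.splitAt-↑ʳ S (suc n) i | Fin.splitAt-↑ʳ S (suc n) j = refl

  det-forestBlock : det S (λ i j → M (suc (i ↑ˡ suc n)) (suc (j ↑ˡ suc n))) ≡ prodF k (λ i → det (m i) (T i))
  det-forestBlock = trans (det-cong S forestBlock) (det-forestMat k m T)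
    where
    forestBlock : ∀ i j → M (suc (i ↑ˡ suc n)) (suc (j ↑ˡ suc n)) ≡ forestMat k m T i j
    forestBlock i j rewrite Fin.splitAt-↑ˡ S i (suc n) | Fin.splitAt-↑ˡ S j (suc n) = refl

  det-cycleBlock : det (suc (suc n)) (λ i j → M (cutVertexʳ S (suc n) i) (cutVertexʳ S (suc n) j))
                     ≡ det (suc (suc n)) C
  det-cycleBlock = trans (det-cong (suc (suc n)) cycleBlock) (det-moveToFront (suc n) v C)
    where
    cycleBlock : ∀ i j → M (cutVertexʳ S (suc n) i) (cutVertexʳ S (suc n) j) ≡ C (moveToFront v i) (moveToFront v j)
    cycleBlock zero    zero    = refl
    cycleBlock zero    (suc c) rewrite Fin.splitAt-↑ʳ S (suc n) c = refl
    cycleBlock (suc c) zero    rewrite Fin.splitAt-↑ʳ S (suc n) c = refl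
    cycleBlock (suc c) (suc d) rewrite Fin.splitAt-↑ʳ S (suc n) c | Fin.splitAt-↑ʳ S (suc n) d = refl

theorem9 : (n : ℕ) → 3 ≤ n →
    (s : Fin n → ℤ) → (∀ i → IsSign (s i)) → (v : Fin n) →
    (k : ℕ) (m : Fin k → ℕ) (T : (i : Fin k) → Mat (m i)) →
    (∀ i → IsSignedTree (T i)) →
    (r : (i : Fin k) → Fin (m i)) → (w : Fin k → ℤ) → (∀ i → IsSign (w i)) →
    (N : ℕ) (e : Fin N ↔ UVertex n k m) →
    det N (λ a b → UMat n k m (cycleMat n s) T r w v
                     (Inverse.to e a) (Inverse.to e b))
      ≡ det n (cycleMat n s) * prodF k (λ i → det (m i) (T i))
        + deleteDet n (cycleMat n s) v
          * sumF k (λ i → det (suc (m i)) (withVertex (T i) (r i) (w i))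
                          * prodF k (λ j → if does (j ≟ i) then 1ℤ
                                           else det (m j) (T j)))
theorem9 (suc zero)       (s≤s ())
theorem9 (suc (suc zero)) (s≤s (s≤s ()))
theorem9 (suc (suc (suc n))) _ s _ v k m T _ r w _ N e =
  trans (det-reindex N (suc (S ℕ.+ suc (suc n))) e layout↔ (UMat (suc (suc (suc n))) k m C T r w v))
  (trans (det-cutVertex S (suc (suc n)) M M-vv≡0 M-trees-cycle≡0 M-cycle-trees≡0)
  (trans (cong₂ _+_ (cong₂ _*_ det-starBlock det-pathBlock) (cong₂ _*_ det-forestBlock det-cycleBlock))
         (rearrange (starSum k m T r w) (deleteDet (suc (suc (suc n))) C v)
                    (prodF k (λ i → det (m i) (T i))) (det (suc (suc (suc n))) C))))
  where
  open UnicyclicBlocks (suc n) s v k m T r w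
  rearrange : ∀ a b c d → a * b + c * d ≡ d * c + b * a
  rearrange = solve-∀
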